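{- Let $(\mathsf{P},\mathcal{I})$ be an instance of interval cover satisfying the standing assumptions, and let $k$ be an even positive integer with $k\le|\mathcal{I}|$. Then $\|\mathcal{G}_k\|\ge \tfrac34\,\mathrm{opt}_k$, where $\mathcal{G}_k$ is the set of the first $k$ greedy intervals.
   Context: An instance of interval cover is a pair $(\mathsf{P},\mathcal{I})$, $\mathsf{P}\subseteq\mathbb{R}$ finite, $\mathcal{I}$ a finite set of intervals. Standing assumptions: all endpoints distinct; no two intervals contain the same subset of $\mathsf{P}$; no interval of $\mathcal{I}$ is contained in another. Measure $\|X\|=|X\cap\mathsf{P}|$, and for a set of intervals the measure of its union. $\mathrm{opt}_t$ is the maximum of $\|\mathcal{Y}\|$ over $\mathcal{Y}\subseteq\mathcal{I}$ with $|\mathcal{Y}|=t$. The greedy algorithm repeatedly adds the interval covering the most points of $\mathsf{P}$ not yet covered (ties broken by the leftmost interval); $g_i$ is its $i$-th choice and $\mathcal{G}_i=\{g_1,\ldots,g_i\}$.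
   Formalization: The points of P and the endpoints of the intervals in $\mathcal{I}$ are rational numbers rather than real numbers. -}

module Defs where

open import Data.Nat using (ℕ; zero; suc; _⊔_; _<ᵇ_)
open import Data.Bool using (Bool; true; false; _∧_; _∨_; not; if_then_else_)
open import Data.List using (List; []; _∷_; _++_; [_]; length; filter; foldr; map; concatMap)
open import Data.Bool.ListAction using (any)
import Data.List.Membership.Propositional
open import Data.List.Relation.Unary.Unique.Propositional using (Unique)
open import Data.Maybe using (Maybe; just; nothing)
open import Data.Product using (_×_; _,_; proj₁; proj₂)
open import Data.Rational using (ℚ; _≤_; _<_)
open import Data.Rational.Properties using (_≤?_; _<?_; _≟_)
open import Relation.Nullary using (¬_; does)
open import Relation.Nullary.Decidable using (⌊_⌋)
open import Relation.Binary.PropositionalEquality using (_≡_; _≢_)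
open import Data.Fin using (Fin)
open import Data.List using (lookup)
open import Data.Product.Properties using (≡-dec)

Interval : Set
Interval = ℚ × ℚ

left right : Interval → ℚ
left  = proj₁
right = proj₂

_∈ᵢ_ : ℚ → Interval → Set
p ∈ᵢ J = left J ≤ p × p ≤ right J

inᵇ : ℚ → Interval → Bool
inᵇ p J = ⌊ left J ≤? p ⌋ ∧ ⌊ p ≤? right J ⌋

_≟ᵢ_ : (J K : Interval) → Relation.Nullary.Dec (J ≡ K)
_≟ᵢ_ = ≡-dec _≟_ _≟_

memᵇ : Interval → List Interval → Bool
memᵇ J Js = any (λ K → ⌊ J ≟ᵢ K ⌋) Js

coveredᵇ : ℚ → List Interval → Bool
coveredᵇ p Js = any (inᵇ p) Js

measure : List ℚ → List Interval → ℕ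
measure P Js = length (filter (λ p → coveredᵇ p Js Data.Bool.≟ true) P)

gain : List ℚ → List Interval → Interval → ℕ
gain P Gs J = length (filter (λ p → (inᵇ p J ∧ not (coveredᵇ p Gs)) Data.Bool.≟ true) P)

preferᵇ : List ℚ → List Interval → Interval → Interval → Bool
preferᵇ P Gs J K =
  (gain P Gs K <ᵇ gain P Gs J) ∨
  (⌊ gain P Gs J Data.Nat.≟ gain P Gs K ⌋ ∧ ⌊ left J <? left K ⌋)

best : List ℚ → List Interval → List Interval → Maybe Interval
best P Gs []       = nothing
best P Gs (J ∷ Js) with best P Gs Js
... | nothing = just J
... | just K  = if preferᵇ P Gs K J then just K else just J

remaining : List Interval → List Interval → List Interval
remaining I Gs = filter (λ J → not (memᵇ J Gs) Data.Bool.≟ true) I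

greedy : List ℚ → List Interval → ℕ → List Interval
greedy P I zero = []
greedy P I (suc i) with best P (greedy P I i) (remaining I (greedy P I i))
... | nothing = greedy P I i
... | just g  = greedy P I i ++ [ g ]

-- all t-element sub-lists (subsets, as I has no repeated entries) of a list
choose : {A : Set} → ℕ → List A → List (List A)
choose zero    xs       = [] ∷ []
choose (suc t) []       = []
choose (suc t) (x ∷ xs) = map (x ∷_) (choose t xs) ++ choose (suc t) xs

maximum : List ℕ → ℕ
maximum = foldr _⊔_ 0

opt : List ℚ → List Interval → ℕ → ℕ
opt P I t = maximum (map (measure P) (choose t I))

endpoints : List Interval → List ℚ
endpoints I = concatMap (λ J → left J ∷ right J ∷ []) I

sameTrace : List ℚ → Interval → Interval → Set
sameTrace P J K = ∀ p → p Data.List.Membership.Propositional.∈ P → (p ∈ᵢ J → p ∈ᵢ K) × (p ∈ᵢ K → p ∈ᵢ J)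

_⊆ᵢ_ : Interval → Interval → Set
J ⊆ᵢ K = left K ≤ left J × right J ≤ right K

record ValidInstance (P : List ℚ) (I : List Interval) : Set where
  field
    points-distinct    : Unique P
    proper             : ∀ (i : Fin (length I)) → left (lookup I i) < right (lookup I i)
    endpoints-distinct : Unique (endpoints I)
    distinct-traces    : ∀ (i j : Fin (length I)) → i ≢ j → ¬ sameTrace P (lookup I i) (lookup I j)
    no-nesting         : ∀ (i j : Fin (length I)) → i ≢ j → ¬ (lookup I i ⊆ᵢ lookup I j)

{-# OPTIONS --safe #-}
-- Fix 𝒴 ⊆ ℐ with |𝒴| = k = 2h. A point covered by 𝒴 is owned by the interval of 𝒴 containing
-- it whose (right, left) endpoint pair is lexicographically largest; the points owned by one
-- interval form a convex block. Let U_i(Z) count the points of the blocks Z not covered by 𝒢_i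
-- and A_i = ‖𝒢_{i+1}‖ - ‖𝒢_i‖. A single block has at most A_i uncovered points, since greedy
-- could have chosen its interval. Step i+1 either finishes some block, or every block it touches
-- is left unfinished and so straddles an endpoint of g_{i+1}, which by convexity happens for at
-- most one block per endpoint. Either way U_i(Z) ≤ 2A_i + U_{i+1}(Z′) for some Z′ with two
-- blocks fewer, and by induction
--   U_i(Z) + 2‖𝒢_i‖ ≤ 2‖𝒢_{i+t}‖  whenever |Z| ≤ 2t.
-- For i = 0 this gives ‖𝒴‖ ≤ 2‖𝒢_h‖, and for i = h, with ‖𝒴‖ ≤ ‖𝒢_h‖ + U_h(𝒴), it gives
-- ‖𝒴‖ ≤ 2‖𝒢_{2h}‖ - ‖𝒢_h‖. The first bound plus twice the second is 3‖𝒴‖ ≤ 4‖𝒢_{2h}‖.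

module Submission where

open import Defs
open import Data.Nat using (ℕ; _*_; _≤_; _<_)
open import Data.Nat.Divisibility using (_∣_; divides)
open import Data.List using (List; length)
open import Data.Rational using (ℚ)

open import Data.Nat using (zero; suc; _+_; _∸_; _⊔_; _<ᵇ_; z≤n; s≤s)
open import Data.Bool using (Bool; true; false; T; _∧_; _∨_; not)
open import Data.Bool.Properties using (T-∧; T-∨; T-≡; ∨-assoc; ∨-identityʳ)
open import Data.Empty using (⊥-elim)
open import Data.List using ([]; _∷_; _++_; [_]; filter; drop; map)
open import Data.List.Membership.Propositional using (_∈_; find; lose)
open import Data.List.Membership.Propositional.Properties
  using (∈-filter⁺; ∈-filter⁻; ∈-++⁺ˡ; ∈-++⁺ʳ; ∈-++⁻; ∈-map⁻; ∈-∃++)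
open import Data.List.Properties using (length-drop)
open import Data.List.Relation.Binary.Permutation.Propositional.Properties using (shift; ↭-length)
open import Data.List.Relation.Binary.Subset.Propositional using (_⊆_)
open import Data.List.Relation.Binary.Subset.Propositional.Properties using (⊆-reflexive-↭; xs⊆x∷xs; ∷⁺ʳ)
open import Data.List.Relation.Unary.All as All using ()
open import Data.List.Relation.Unary.Any as Any using (Any; here; there; any?; satisfied)
open import Data.List.Relation.Unary.Any.Properties using (any⁺; any⁻)
open import Data.Maybe using (Maybe; just; nothing; maybe)
open import Data.Maybe.Properties using (just-injective)
import Data.Maybe.Properties as Maybe
open import Data.Nat.Properties
open import Algebra.Properties.CommutativeSemigroup +-commutativeSemigroup using (interchange)
open import Data.Nat.Tactic.RingSolver using (solve-∀)
open import Data.Product using (∃-syntax; _×_; _,_; proj₁; proj₂; swap)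
open import Data.Product.Relation.Binary.Lex.NonStrict using (×-totalOrder)
import Data.Rational as ℚ
import Data.Rational.Properties as ℚ
open import Data.Sum using (_⊎_; inj₁; inj₂)
open import Function using (id; _∘_; case_of_; Equivalence)
open import Level using (0ℓ)
open import Relation.Binary using (TotalOrder; DecTotalOrder)
open import Relation.Unary using (Pred; Decidable)
open import Relation.Unary.Properties using (∁?)
open import Relation.Binary.PropositionalEquality
  using (_≡_; _≢_; refl; sym; trans; cong; cong₂; subst; module ≡-Reasoning)
open import Relation.Nullary using (¬_; Dec; yes; no; does)
open import Relation.Nullary.Decidable using (⌊_⌋; toWitness; fromWitness; _×-dec_; _⊎-dec_; T?; toSum)

open Equivalence using (to; from)

T-not⁺ : ∀ {b} → ¬ T b → T (not b)
T-not⁺ {false} _ = _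
T-not⁺ {true}  h = h _

T-not⁻ : ∀ {b} → T (not b) → ¬ T b
T-not⁻ {false} _ ()

indicator : Bool → ℕ
indicator true  = 1
indicator false = 0

indicator-mono : ∀ {a b} → (T a → T b) → indicator a ≤ indicator b
indicator-mono {false}         _ = z≤n
indicator-mono {true} {true}   _ = ≤-refl
indicator-mono {true} {false}  h = ⊥-elim (h _)

indicator-≤-+ : ∀ {a b c} → (T a → T b ⊎ T c) → indicator a ≤ indicator b + indicator c
indicator-≤-+ {false}                 _ = z≤n
indicator-≤-+ {true} {true}           _ = s≤s z≤n
indicator-≤-+ {true} {false} {true}   _ = ≤-refl
indicator-≤-+ {true} {false} {false}  h with h _
... | inj₁ ()
... | inj₂ ()

indicator-split : ∀ a b → indicator a ≡ indicator (a ∧ b) + indicator (a ∧ not b)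
indicator-split false _     = refl
indicator-split true  true  = refl
indicator-split true  false = refl

module _ {A : Set} where

  -- `measure` and `gain` of Defs are instances of `count` by definition.
  count : (A → Bool) → List A → ℕ
  count a xs = length (filter (λ x → a x Data.Bool.≟ true) xs)

  count-∷ : ∀ a x xs → count a (x ∷ xs) ≡ indicator (a x) + count a xs
  count-∷ a x xs with a x
  ... | true  = refl
  ... | false = refl

  count-none : ∀ {a} xs → (∀ {x} → x ∈ xs → ¬ T (a x)) → count a xs ≡ 0
  count-none         []       _ = refl
  count-none {a} (x ∷ xs) h with a x | h (here refl)
  ... | true  | ¬ax = ⊥-elim (¬ax _)
  ... | false | _   = count-none xs (h ∘ there)

  count-witness : ∀ {a} xs → count a xs ≢ 0 → ∃[ x ] x ∈ xs × T (a x)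
  count-witness         []       h = ⊥-elim (h refl)
  count-witness {a} (x ∷ xs) h with a x in ax
  ... | true  = x , here refl , from T-≡ ax
  ... | false = let y , y∈ , ay = count-witness xs h in y , there y∈ , ay

  count-mono : ∀ {a b} xs → (∀ {x} → x ∈ xs → T (a x) → T (b x)) → count a xs ≤ count b xs
  count-mono         []       _ = z≤n
  count-mono {a} {b} (x ∷ xs) h = begin
    count a (x ∷ xs)              ≡⟨ count-∷ a x xs ⟩
    indicator (a x) + count a xs  ≤⟨ +-mono-≤ (indicator-mono (h (here refl)))
                                              (count-mono xs (h ∘ there)) ⟩
    indicator (b x) + count b xs  ≡⟨ count-∷ b x xs ⟨
    count b (x ∷ xs)              ∎
    where open ≤-Reasoning

  count-≤-+ : ∀ {a b c} xs → (∀ {x} → x ∈ xs → T (a x) → T (b x) ⊎ T (c x)) →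
              count a xs ≤ count b xs + count c xs
  count-≤-+             []       _ = z≤n
  count-≤-+ {a} {b} {c} (x ∷ xs) h = begin
    count a (x ∷ xs)
      ≡⟨ count-∷ a x xs ⟩
    indicator (a x) + count a xs
      ≤⟨ +-mono-≤ (indicator-≤-+ (h (here refl))) (count-≤-+ xs (h ∘ there)) ⟩
    (indicator (b x) + indicator (c x)) + (count b xs + count c xs)
      ≡⟨ interchange (indicator (b x)) _ _ _ ⟩
    (indicator (b x) + count b xs) + (indicator (c x) + count c xs)
      ≡⟨ cong₂ _+_ (count-∷ b x xs) (count-∷ c x xs) ⟨
    count b (x ∷ xs) + count c (x ∷ xs) ∎
    where open ≤-Reasoning

  count-split : ∀ (a b : A → Bool) xs →
                count a xs ≡ count (λ x → a x ∧ b x) xs + count (λ x → a x ∧ not (b x)) xs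
  count-split a b []       = refl
  count-split a b (x ∷ xs) = begin
    count a (x ∷ xs)
      ≡⟨ count-∷ a x xs ⟩
    indicator (a x) + count a xs
      ≡⟨ cong₂ _+_ (indicator-split (a x) (b x)) (count-split a b xs) ⟩
    (indicator (a∧b x) + indicator (a∧¬b x)) + (count a∧b xs + count a∧¬b xs)
      ≡⟨ interchange (indicator (a∧b x)) _ _ _ ⟩
    (indicator (a∧b x) + count a∧b xs) + (indicator (a∧¬b x) + count a∧¬b xs)
      ≡⟨ cong₂ _+_ (count-∷ a∧b x xs) (count-∷ a∧¬b x xs) ⟨
    count a∧b (x ∷ xs) + count a∧¬b (x ∷ xs) ∎
    where
    open ≡-Reasoning
    a∧b a∧¬b : A → Bool
    a∧b  y = a y ∧ b y
    a∧¬b y = a y ∧ not (b y)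

drop-⊆ : ∀ {A : Set} n (xs : List A) → drop n xs ⊆ xs
drop-⊆ zero    xs       = id
drop-⊆ (suc n) []       = id
drop-⊆ (suc n) (x ∷ xs) = there ∘ drop-⊆ n xs

module _ {A : Set} {Q : Pred A 0ℓ} (Q? : Decidable Q) where

  filter-++-∁-⊇ : ∀ xs → xs ⊆ filter Q? xs ++ filter (∁? Q?) xs
  filter-++-∁-⊇ xs {x} x∈ with Q? x
  ... | yes qx = ∈-++⁺ˡ (∈-filter⁺ Q? x∈ qx)
  ... | no ¬qx = ∈-++⁺ʳ (filter Q? xs) (∈-filter⁺ (∁? Q?) x∈ ¬qx)

  length-filter-+-∁ : ∀ xs → length (filter Q? xs) + length (filter (∁? Q?) xs) ≡ length xs
  length-filter-+-∁ []       = refl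
  length-filter-+-∁ (x ∷ xs) with does (Q? x)
  ... | true  = cong suc (length-filter-+-∁ xs)
  ... | false = trans (+-suc _ _) (cong suc (length-filter-+-∁ xs))

∸-∸-≤ : ∀ m n → n ∸ (2 ∸ m) ≤ (m + n) ∸ 2
∸-∸-≤ 0             n = ≤-refl
∸-∸-≤ 1             n = ≤-refl
∸-∸-≤ (suc (suc m)) n rewrite 0∸n≡0 m = m≤n+m n m

pad-to-two : ∀ m {u a} → u ≤ m * a → u ≤ 2 * a → u + (2 ∸ m) * a ≤ 2 * a
pad-to-two 0             u≤0 _ rewrite n≤0⇒n≡0 u≤0 = ≤-refl
pad-to-two 1 {u} {a}     u≤a _ = +-monoˡ-≤ (1 * a) (subst (u ≤_) (+-identityʳ a) u≤a)
pad-to-two (suc (suc m)) {u} _ u≤2a rewrite 0∸n≡0 m = subst (_≤ _) (sym (+-identityʳ u)) u≤2a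

∉ᵢ⇒outside : ∀ {q J} → ¬ q ∈ᵢ J → q ℚ.< left J ⊎ right J ℚ.< q
∉ᵢ⇒outside {q} {J} q∉ with left J ℚ.≤? q
... | no  l≰q = inj₁ (ℚ.≰⇒> l≰q)
... | yes l≤q = inj₂ (ℚ.≰⇒> (λ q≤r → q∉ (l≤q , q≤r)))

inᵇ⇒∈ᵢ : ∀ {p J} → T (inᵇ p J) → p ∈ᵢ J
inᵇ⇒∈ᵢ {p} {J} h = let l , r = to (T-∧ {⌊ left J ℚ.≤? p ⌋}) h in
  toWitness {a? = left J ℚ.≤? p} l , toWitness {a? = p ℚ.≤? right J} r

∈ᵢ⇒inᵇ : ∀ {p J} → p ∈ᵢ J → T (inᵇ p J)
∈ᵢ⇒inᵇ {p} {J} (l , r) =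
  from T-∧ (fromWitness {a? = left J ℚ.≤? p} l , fromWitness {a? = p ℚ.≤? right J} r)

memᵇ⇒∈ : ∀ {J} Gs → T (memᵇ J Gs) → J ∈ Gs
memᵇ⇒∈ {J} Gs m = Any.map (λ {K} → toWitness {a? = J ≟ᵢ K}) (any⁻ _ Gs m)

∈⇒memᵇ : ∀ {J Gs} → J ∈ Gs → T (memᵇ J Gs)
∈⇒memᵇ {J} J∈ = any⁺ _ (Any.map (λ { refl → fromWitness {a? = J ≟ᵢ J} refl }) J∈)

∈⇒coveredᵇ : ∀ {p J Gs} → J ∈ Gs → T (inᵇ p J) → T (coveredᵇ p Gs)
∈⇒coveredᵇ J∈ pJ = any⁺ _ (Any.map (λ { refl → pJ }) J∈)

coveredᵇ-∷ʳ : ∀ p Gs g → coveredᵇ p (Gs ++ [ g ]) ≡ coveredᵇ p Gs ∨ inᵇ p g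
coveredᵇ-∷ʳ p []       g = ∨-identityʳ (inᵇ p g)
coveredᵇ-∷ʳ p (K ∷ Gs) g = trans (cong (inᵇ p K ∨_) (coveredᵇ-∷ʳ p Gs g)) (sym (∨-assoc (inᵇ p K) _ _))

chosen⇒gain≡0 : ∀ P {J} Gs → T (memᵇ J Gs) → gain P Gs J ≡ 0
chosen⇒gain≡0 P Gs m = count-none P λ _ h →
  let pJ , uncov = to T-∧ h in T-not⁻ uncov (∈⇒coveredᵇ (memᵇ⇒∈ Gs m) pJ)

∈-remaining : ∀ {I J} Gs → J ∈ I → T (memᵇ J Gs) ⊎ J ∈ remaining I Gs
∈-remaining {J = J} Gs J∈ with memᵇ J Gs in m
... | true  = inj₁ _
... | false = inj₂ (∈-filter⁺ (λ K → not (memᵇ K Gs) Data.Bool.≟ true) J∈ (cong not m))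

lexicographic-≥ : ∀ m n b → T ((n <ᵇ m) ∨ (⌊ m Data.Nat.≟ n ⌋ ∧ b)) → n ≤ m
lexicographic-≥ m n b h with n <ᵇ m in n<m | m Data.Nat.≟ n
... | true  | _        = <⇒≤ (<ᵇ⇒< n m (from T-≡ n<m))
... | false | yes refl = ≤-refl
... | false | no _     = ⊥-elim h

preferred-gain : ∀ P Gs {J K} → T (preferᵇ P Gs K J) → gain P Gs J ≤ gain P Gs K
preferred-gain P Gs {J} {K} = lexicographic-≥ (gain P Gs K) (gain P Gs J) _

unpreferred-gain : ∀ P Gs {J K} → ¬ T (preferᵇ P Gs K J) → gain P Gs K ≤ gain P Gs J
unpreferred-gain P Gs h = ≮⇒≥ (λ J<K → h (from T-∨ (inj₁ (<⇒<ᵇ J<K))))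

best-nothing : ∀ P Gs L → best P Gs L ≡ nothing → L ≡ []
best-nothing P Gs []       _ = refl
best-nothing P Gs (J ∷ Js) e with best P Gs Js
best-nothing P Gs (J ∷ Js) () | nothing
... | just K with preferᵇ P Gs K J
best-nothing P Gs (J ∷ Js) () | just K | true
best-nothing P Gs (J ∷ Js) () | just K | false

best-max : ∀ P Gs L {g J} → best P Gs L ≡ just g → J ∈ L → gain P Gs J ≤ gain P Gs g
best-max P Gs (K ∷ Ks) e J∈ with best P Gs Ks in e′
best-max P Gs (K ∷ Ks) refl (here refl) | nothing = ≤-refl
best-max P Gs (K ∷ Ks) refl (there J∈)  | nothing with () ← subst (_ ∈_) (best-nothing P Gs Ks e′) J∈
... | just K′ with preferᵇ P Gs K′ K in pref
best-max P Gs (K ∷ Ks) refl (here refl) | just K′ | true  = preferred-gain P Gs (from T-≡ pref)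
best-max P Gs (K ∷ Ks) refl (there J∈)  | just K′ | true  = best-max P Gs Ks e′ J∈
best-max P Gs (K ∷ Ks) refl (here refl) | just K′ | false = ≤-refl
best-max P Gs (K ∷ Ks) refl (there J∈)  | just K′ | false =
  ≤-trans (best-max P Gs Ks e′ J∈) (unpreferred-gain P Gs (subst T pref))

-- The greedy algorithm

module Greedy (P : List ℚ) (I : List Interval) where

  extendBy : List Interval → Maybe Interval → List Interval
  extendBy Gs nothing  = Gs
  extendBy Gs (just g) = Gs ++ [ g ]

  greedy-suc : ∀ i → greedy P I (suc i) ≡
               extendBy (greedy P I i) (best P (greedy P I i) (remaining I (greedy P I i)))
  greedy-suc i with best P (greedy P I i) (remaining I (greedy P I i))
  ... | nothing = refl
  ... | just g  = refl

  data Step (i : ℕ) : Set where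
    halt : greedy P I (suc i) ≡ greedy P I i →
           (∀ {J} → J ∈ I → gain P (greedy P I i) J ≡ 0) → Step i
    pick : ∀ g → greedy P I (suc i) ≡ greedy P I i ++ [ g ] →
           (∀ {J} → J ∈ I → gain P (greedy P I i) J ≤ gain P (greedy P I i) g) → Step i

  step : ∀ i → Step i
  step i = stepBy (best P Gs (remaining I Gs)) refl (greedy-suc i)
    where
    Gs = greedy P I i

    stepBy : ∀ m → best P Gs (remaining I Gs) ≡ m → greedy P I (suc i) ≡ extendBy Gs m → Step i
    stepBy nothing e eq = halt eq λ J∈ → gain-zero (∈-remaining Gs J∈)
      where
      gain-zero : ∀ {J} → T (memᵇ J Gs) ⊎ J ∈ remaining I Gs → gain P Gs J ≡ 0
      gain-zero (inj₁ chosen) = chosen⇒gain≡0 P Gs chosen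
      gain-zero (inj₂ J∈) with () ← subst (_ ∈_) (best-nothing P Gs _ e) J∈
    stepBy (just g) e eq = pick g eq λ J∈ → gain-max (∈-remaining Gs J∈)
      where
      gain-max : ∀ {J} → T (memᵇ J Gs) ⊎ J ∈ remaining I Gs → gain P Gs J ≤ gain P Gs g
      gain-max (inj₁ chosen) = subst (_≤ _) (sym (chosen⇒gain≡0 P Gs chosen)) z≤n
      gain-max (inj₂ J∈)     = best-max P Gs _ e J∈

  covered : ℕ → ℚ → Bool
  covered i p = coveredᵇ p (greedy P I i)

  greedyMeasure : ℕ → ℕ
  greedyMeasure i = count (covered i) P

  increment : ℕ → ℕ
  increment i = count (λ p → covered (suc i) p ∧ not (covered i p)) P

  covered-pick : ∀ {i g} p → greedy P I (suc i) ≡ greedy P I i ++ [ g ] →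
                 covered (suc i) p ≡ covered i p ∨ inᵇ p g
  covered-pick {i} {g} p eq = trans (cong (coveredᵇ p) eq) (coveredᵇ-∷ʳ p (greedy P I i) g)

  covered-mono : ∀ i {p} → T (covered i p) → T (covered (suc i) p)
  covered-mono i {p} h with step i
  ... | halt eq _   = subst (λ Gs → T (coveredᵇ p Gs)) (sym eq) h
  ... | pick g eq _ = subst T (sym (covered-pick p eq)) (from T-∨ (inj₁ h))

  greedyMeasure-zero : greedyMeasure 0 ≡ 0
  greedyMeasure-zero = count-none P λ _ ()

  greedyMeasure-suc : ∀ i → greedyMeasure i + increment i ≤ greedyMeasure (suc i)
  greedyMeasure-suc i = begin
    greedyMeasure i + increment i
      ≤⟨ +-monoˡ-≤ (increment i) (count-mono P λ _ c → from T-∧ (covered-mono i c , c)) ⟩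
    count (λ p → covered (suc i) p ∧ covered i p) P + increment i
      ≡⟨ count-split (covered (suc i)) (covered i) P ⟨
    greedyMeasure (suc i) ∎
    where open ≤-Reasoning

  gain≤increment : ∀ i {J} → J ∈ I → gain P (greedy P I i) J ≤ increment i
  gain≤increment i J∈ with step i
  ... | halt _ noGain    = subst (_≤ _) (sym (noGain J∈)) z≤n
  ... | pick g eq maxGain = ≤-trans (maxGain J∈) (count-mono P λ {p} _ h →
    let pg , uncov = to T-∧ h
    in from T-∧ (subst T (sym (covered-pick p eq)) (from T-∨ (inj₂ pg)) , uncov))

-- Blocks of a family 𝒴

-- Comparing right endpoints first is what makes blocks convex; left endpoints only break ties.
keyOrder : TotalOrder _ _ _
keyOrder = ×-totalOrder ℚ.≤-decTotalOrder (DecTotalOrder.totalOrder ℚ.≤-decTotalOrder)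

open TotalOrder keyOrder using () renaming (_≤_ to _≤ₖ_; antisym to ≤ₖ-antisym)
open import Data.List.Extrema keyOrder using (argmax; argmax-sel; f[⊥]≤f[argmax]; f[xs]≤f[argmax])

key : Interval → ℚ × ℚ
key = swap

key-≤⇒right-≤ : ∀ {J K} → key J ≤ₖ key K → right J ℚ.≤ right K
key-≤⇒right-≤ (inj₁ (r≤r , _)) = r≤r
key-≤⇒right-≤ (inj₂ (refl , _)) = ℚ.≤-refl

key-antisym : ∀ {J K} → key J ≤ₖ key K → key K ≤ₖ key J → J ≡ K
key-antisym J≤K K≤J = let r≡r , l≡l = ≤ₖ-antisym J≤K K≤J in cong₂ _,_ l≡l r≡r

_∈ᵢ?_ : ∀ p J → Dec (p ∈ᵢ J)
p ∈ᵢ? J = (left J ℚ.≤? p) ×-dec (p ℚ.≤? right J)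

maxKey : List Interval → Maybe Interval
maxKey []       = nothing
maxKey (J ∷ Js) = just (argmax key J Js)

maxKey-∈ : ∀ L {J} → maxKey L ≡ just J → J ∈ L
maxKey-∈ (K ∷ Ks) refl with argmax-sel key K Ks
... | inj₁ eq = here eq
... | inj₂ J∈ = there J∈

maxKey-max : ∀ {L K} → K ∈ L → ∃[ J ] maxKey L ≡ just J × key K ≤ₖ key J
maxKey-max {K₀ ∷ Ks} (here refl) = _ , refl , f[⊥]≤f[argmax] {f = key} K₀ Ks
maxKey-max {K₀ ∷ Ks} (there K∈)  = _ , refl , All.lookup (f[xs]≤f[argmax] {f = key} K₀ Ks) K∈

module Blocks (Y : List Interval) where

  owner : ℚ → Maybe Interval
  owner p = maxKey (filter (p ∈ᵢ?_) Y)

  owner-sound : ∀ {p J} → owner p ≡ just J → J ∈ Y × p ∈ᵢ J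
  owner-sound {p} e = ∈-filter⁻ (p ∈ᵢ?_) (maxKey-∈ _ e)

  owner-max : ∀ {p K} → K ∈ Y → p ∈ᵢ K → ∃[ J ] owner p ≡ just J × key K ≤ₖ key J
  owner-max {p} K∈ pK = maxKey-max (∈-filter⁺ (p ∈ᵢ?_) K∈ pK)

  owner-convex : ∀ {a b r J} → owner a ≡ just J → owner b ≡ just J → a ℚ.≤ r → r ℚ.≤ b → owner r ≡ just J
  -- The owner J′ of r reaches at least as far right as J, so it contains b, where J is maximal.
  owner-convex ea eb a≤r r≤b
    with J∈ , l≤a , _ ← owner-sound ea
    with _ , _ , b≤r ← owner-sound eb
    with J′ , er , J≤J′ ← owner-max J∈ (ℚ.≤-trans l≤a a≤r , ℚ.≤-trans r≤b b≤r)
    with J′∈ , l′≤r , _ ← owner-sound er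
    with _ , eb′ , J′≤J ← owner-max J′∈ (ℚ.≤-trans l′≤r r≤b , ℚ.≤-trans b≤r (key-≤⇒right-≤ J≤J′))
    with refl ← trans (sym eb′) eb
    = trans er (cong just (key-antisym J′≤J J≤J′))

  owner-overlap : ∀ {a b a′ b′ J J′} → owner a ≡ just J → owner b ≡ just J →
                  owner a′ ≡ just J′ → owner b′ ≡ just J′ → a ℚ.≤ b′ → a′ ℚ.≤ b → J ≡ J′
  owner-overlap {a} {a′ = a′} ea eb ea′ eb′ a≤b′ a′≤b with ℚ.≤-total a a′
  ... | inj₁ a≤a′ = just-injective (trans (sym (owner-convex ea eb a≤a′ a′≤b)) ea′)
  ... | inj₂ a′≤a = just-injective (trans (sym ea) (owner-convex ea′ eb′ a′≤a a≤b′))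

  ownedBy : List Interval → ℚ → Bool
  ownedBy Z p = maybe (λ J → memᵇ J Z) false (owner p)

  ownedBy-intro : ∀ Z {p J} → owner p ≡ just J → J ∈ Z → T (ownedBy Z p)
  ownedBy-intro Z e J∈ rewrite e = ∈⇒memᵇ J∈

  ownedBy-elim : ∀ {Z p} → T (ownedBy Z p) → ∃[ J ] owner p ≡ just J × J ∈ Z
  ownedBy-elim {Z} {p} h with owner p | h
  ... | just J | m = J , refl , memᵇ⇒∈ Z m

module Uncovered (P : List ℚ) (I : List Interval) (Y : List Interval) (Y⊆I : Y ⊆ I) where
  open Greedy P I
  open Blocks Y

  uncovered : ℕ → List Interval → ℕ
  uncovered i Z = count (λ p → ownedBy Z p ∧ not (covered i p)) P

  counted⇒owned : ∀ i Z {p} → T (ownedBy Z p ∧ not (covered i p)) →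
                  ∃[ J ] owner p ≡ just J × J ∈ Z × ¬ T (covered i p)
  counted⇒owned i Z h =
    let o , u = to T-∧ h
        J , e , J∈ = ownedBy-elim o
    in J , e , J∈ , T-not⁻ u

  owned⇒counted : ∀ i Z {p J} → owner p ≡ just J → J ∈ Z → ¬ T (covered i p) →
                  T (ownedBy Z p ∧ not (covered i p))
  owned⇒counted i Z e J∈ u = from T-∧ (ownedBy-intro Z e J∈ , T-not⁺ u)

  uncovered-[] : ∀ i → uncovered i [] ≡ 0
  uncovered-[] i = count-none P λ _ h → case counted⇒owned i [] h of λ ()

  uncovered-mono : ∀ i {Z} Z′ → Z ⊆ Z′ → uncovered i Z ≤ uncovered i Z′
  uncovered-mono i {Z} Z′ Z⊆Z′ = count-mono P λ _ h →
    let _ , e , J∈ , u = counted⇒owned i Z h in owned⇒counted i Z′ e (Z⊆Z′ J∈) u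

  uncovered-⊆-++ : ∀ i {Z} Z₁ Z₂ → Z ⊆ Z₁ ++ Z₂ → uncovered i Z ≤ uncovered i Z₁ + uncovered i Z₂
  uncovered-⊆-++ i {Z} Z₁ Z₂ Z⊆ = count-≤-+ P λ _ h →
    let _ , e , J∈ , u = counted⇒owned i Z h
    in Data.Sum.map (λ J∈₁ → owned⇒counted i Z₁ e J∈₁ u) (λ J∈₂ → owned⇒counted i Z₂ e J∈₂ u)
                    (∈-++⁻ Z₁ (Z⊆ J∈))

  uncovered-∷ : ∀ i J Z → uncovered i (J ∷ Z) ≤ uncovered i [ J ] + uncovered i Z
  uncovered-∷ i J Z = uncovered-⊆-++ i [ J ] Z id

  uncovered-suc : ∀ i Z → uncovered (suc i) Z ≤ uncovered i Z
  uncovered-suc i Z = count-mono P λ _ h →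
    let _ , e , J∈ , u = counted⇒owned (suc i) Z h in owned⇒counted i Z e J∈ (u ∘ covered-mono i)

  uncovered-step : ∀ i Z → uncovered i Z ≤ increment i + uncovered (suc i) Z
  uncovered-step i Z = count-≤-+ P λ {p} _ h →
    let _ , e , J∈ , u = counted⇒owned i Z h in
    Data.Sum.map (λ c → from T-∧ (c , T-not⁺ u)) (owned⇒counted (suc i) Z e J∈)
                 (toSum (T? (covered (suc i) p)))

  uncovered-≤-gain : ∀ i J → uncovered i [ J ] ≤ gain P (greedy P I i) J
  uncovered-≤-gain i J = count-mono P λ _ h → in-block (counted⇒owned i [ J ] h)
    where
    in-block : ∀ {p} → ∃[ K ] owner p ≡ just K × K ∈ [ J ] × ¬ T (covered i p) →
               T (inᵇ p J ∧ not (covered i p))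
    in-block (_ , e , here refl , u) = from T-∧ (∈ᵢ⇒inᵇ (proj₂ (owner-sound e)) , T-not⁺ u)

  uncovered-singleton : ∀ i J → uncovered i [ J ] ≤ increment i
  -- Only a block that owns some point is an interval of 𝒴 ⊆ ℐ, hence a candidate of the greedy step.
  uncovered-singleton i J with uncovered i [ J ] Data.Nat.≟ 0
  ... | yes none = subst (_≤ _) (sym none) z≤n
  ... | no some
    with _ , _ , h ← count-witness P some
    with _ , e , here refl , _ ← counted⇒owned i [ J ] h
    = ≤-trans (uncovered-≤-gain i J) (gain≤increment i (Y⊆I (proj₁ (owner-sound e))))

  uncovered-length : ∀ i Z → uncovered i Z ≤ length Z * increment i
  uncovered-length i []      = ≤-reflexive (uncovered-[] i)
  uncovered-length i (J ∷ Z) =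
    ≤-trans (uncovered-∷ i J Z) (+-mono-≤ (uncovered-singleton i J) (uncovered-length i Z))

  uncovered-drop : ∀ j {a} → (∀ J → uncovered j [ J ] ≤ a) →
                   ∀ n Z → uncovered j Z ≤ n * a + uncovered j (drop n Z)
  uncovered-drop j     _     zero    Z       = ≤-refl
  uncovered-drop j     _     (suc n) []      = ≤-trans (≤-reflexive (uncovered-[] j)) z≤n
  uncovered-drop j {a} bound (suc n) (J ∷ Z) = begin
    uncovered j (J ∷ Z)                   ≤⟨ uncovered-∷ j J Z ⟩
    uncovered j [ J ] + uncovered j Z     ≤⟨ +-mono-≤ (bound J) (uncovered-drop j bound n Z) ⟩
    a + (n * a + uncovered j (drop n Z))  ≡⟨ +-assoc a (n * a) _ ⟨
    suc n * a + uncovered j (drop n Z)    ∎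
    where open ≤-Reasoning

  uncovered-subsingleton : ∀ i Z → (∀ {J J′} → J ∈ Z → J′ ∈ Z → J ≡ J′) → uncovered i Z ≤ increment i
  uncovered-subsingleton i []      _    = ≤-trans (≤-reflexive (uncovered-[] i)) z≤n
  uncovered-subsingleton i (J ∷ Z) same =
    ≤-trans (uncovered-mono i [ J ] λ J′∈ → here (same J′∈ (here refl))) (uncovered-singleton i J)

  measure-≤-uncovered : ∀ i → measure P Y ≤ greedyMeasure i + uncovered i Y
  measure-≤-uncovered i = count-≤-+ P λ {p} _ h →
    Data.Sum.map id (covered-by-block p h) (toSum (T? (covered i p)))
    where
    covered-by-block : ∀ p → T (coveredᵇ p Y) → ¬ T (covered i p) → T (ownedBy Y p ∧ not (covered i p))
    covered-by-block p h u
      with K , K∈ , pK ← find (any⁻ (inᵇ p) Y h)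
      with _ , e , _ ← owner-max K∈ (inᵇ⇒∈ᵢ pK)
      = owned⇒counted i Y e (proj₁ (owner-sound e)) u

  -- Retiring two blocks per greedy step

  record Retirement (i : ℕ) (Z : List Interval) : Set where
    constructor retirement
    field
      survivors       : List Interval
      survivors-fewer : length survivors ≤ length Z ∸ 2
      uncovered-bound : uncovered i Z ≤ 2 * increment i + uncovered (suc i) survivors

  retire-halt : ∀ {i} Z → greedy P I (suc i) ≡ greedy P I i → Retirement i Z
  retire-halt {i} Z halted = retirement (drop 2 Z) (≤-reflexive (length-drop 2 Z)) (begin
    uncovered i Z                                   ≤⟨ uncovered-drop i (uncovered-singleton i) 2 Z ⟩
    2 * increment i + uncovered i (drop 2 Z)
      ≡⟨ cong (λ Gs → 2 * increment i + count (λ p → ownedBy (drop 2 Z) p ∧ not (coveredᵇ p Gs)) P)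
              halted ⟨
    2 * increment i + uncovered (suc i) (drop 2 Z)  ∎)
    where open ≤-Reasoning

  retire-finished : ∀ {i x Z} → x ∈ Z → uncovered (suc i) [ x ] ≡ 0 → Retirement i Z
  retire-finished {i} {x} x∈ finished with ys , zs , refl ← ∈-∃++ x∈ =
    retirement (drop 1 R) fewer (begin
      uncovered i Z                                                  ≤⟨ uncovered-step i Z ⟩
      increment i + uncovered (suc i) Z
        ≤⟨ +-monoʳ-≤ (increment i) (uncovered-⊆-++ (suc i) [ x ] R (⊆-reflexive-↭ Z↭)) ⟩
      increment i + (uncovered (suc i) [ x ] + uncovered (suc i) R)
        ≡⟨ cong (λ u → increment i + (u + uncovered (suc i) R)) finished ⟩
      increment i + uncovered (suc i) R
        ≤⟨ +-monoʳ-≤ (increment i) (uncovered-drop (suc i) singleton 1 R) ⟩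
      increment i + (1 * increment i + uncovered (suc i) (drop 1 R)) ≡⟨ +-assoc (increment i) _ _ ⟨
      2 * increment i + uncovered (suc i) (drop 1 R)                 ∎)
    where
    open ≤-Reasoning
    Z = ys ++ [ x ] ++ zs
    R = ys ++ zs
    Z↭ = shift x ys zs
    fewer : length (drop 1 R) ≤ length Z ∸ 2
    fewer = ≤-reflexive (trans (length-drop 1 R) (cong (_∸ 2) (sym (↭-length Z↭))))
    singleton : ∀ J → uncovered (suc i) [ J ] ≤ increment i
    singleton J = ≤-trans (uncovered-suc i [ J ]) (uncovered-singleton i J)

  module Straddling (i : ℕ) (g : Interval) (picked : greedy P I (suc i) ≡ greedy P I i ++ [ g ]) where

    MeetsChoice PointLeft PointRight : Interval → Set
    MeetsChoice J = Any (λ p → owner p ≡ just J × p ∈ᵢ g) P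
    PointLeft   J = Any (λ q → owner q ≡ just J × q ℚ.< left g) P
    PointRight  J = Any (λ q → owner q ≡ just J × right g ℚ.< q) P

    Straddles : Interval → Set
    Straddles J = MeetsChoice J × (PointLeft J ⊎ PointRight J)

    owner? : ∀ p J → Dec (owner p ≡ just J)
    owner? p J = Maybe.≡-dec _≟ᵢ_ (owner p) (just J)

    pointLeft? : Decidable PointLeft
    pointLeft? J = any? (λ q → owner? q J ×-dec q ℚ.<? left g) P

    straddles? : Decidable Straddles
    straddles? J = any? (λ p → owner? p J ×-dec p ∈ᵢ? g) P
             ×-dec (pointLeft? J ⊎-dec any? (λ q → owner? q J ×-dec right g ℚ.<? q) P)

    straddle-left-unique : ∀ {J J′} → MeetsChoice J → PointLeft J →
                           MeetsChoice J′ → PointLeft J′ → J ≡ J′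
    straddle-left-unique meets left meets′ left′
      with _ , ep , pg ← satisfied meets
      with _ , eq , q<l ← satisfied left
      with _ , ep′ , p′g ← satisfied meets′
      with _ , eq′ , q′<l ← satisfied left′
      = owner-overlap eq ep eq′ ep′ (ℚ.<⇒≤ (ℚ.<-≤-trans q<l (proj₁ p′g)))
                                    (ℚ.<⇒≤ (ℚ.<-≤-trans q′<l (proj₁ pg)))

    straddle-right-unique : ∀ {J J′} → MeetsChoice J → PointRight J →
                            MeetsChoice J′ → PointRight J′ → J ≡ J′
    straddle-right-unique meets right meets′ right′
      with _ , ep , pg ← satisfied meets
      with _ , eq , r<q ← satisfied right
      with _ , ep′ , p′g ← satisfied meets′
      with _ , eq′ , r<q′ ← satisfied right′
      = owner-overlap ep eq ep′ eq′ (ℚ.<⇒≤ (ℚ.≤-<-trans (proj₂ pg) r<q′))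
                                    (ℚ.<⇒≤ (ℚ.≤-<-trans (proj₂ p′g) r<q))

    uncovered-straddling : ∀ Z → (∀ {J} → J ∈ Z → Straddles J) → uncovered i Z ≤ 2 * increment i
    uncovered-straddling Z straddling = begin
      uncovered i Z
        ≤⟨ uncovered-⊆-++ i Zl Zr (filter-++-∁-⊇ pointLeft? Z) ⟩
      uncovered i Zl + uncovered i Zr
        ≤⟨ +-mono-≤ (uncovered-subsingleton i Zl left-unique)
                    (≤-trans (uncovered-subsingleton i Zr right-unique) (m≤m+n _ 0)) ⟩
      2 * increment i ∎
      where
      open ≤-Reasoning
      Zl = filter pointLeft? Z
      Zr = filter (∁? pointLeft?) Z
      left-unique : ∀ {J J′} → J ∈ Zl → J′ ∈ Zl → J ≡ J′
      left-unique J∈ J′∈ =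
        let J∈Z , l = ∈-filter⁻ pointLeft? J∈
            J′∈Z , l′ = ∈-filter⁻ pointLeft? J′∈
        in straddle-left-unique (proj₁ (straddling J∈Z)) l (proj₁ (straddling J′∈Z)) l′
      right-point : ∀ {J} → J ∈ Zr → MeetsChoice J × PointRight J
      right-point J∈ with J∈Z , ¬l ← ∈-filter⁻ (∁? pointLeft?) J∈ with straddling J∈Z
      ... | meets , inj₁ l = ⊥-elim (¬l l)
      ... | meets , inj₂ r = meets , r
      right-unique : ∀ {J J′} → J ∈ Zr → J′ ∈ Zr → J ≡ J′
      right-unique J∈ J′∈ =
        let meets , r = right-point J∈
            meets′ , r′ = right-point J′∈
        in straddle-right-unique meets r meets′ r′

    newly-covered-in-choice : ∀ {p} → T (covered (suc i) p) → ¬ T (covered i p) → p ∈ᵢ g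
    newly-covered-in-choice {p} c u with to T-∨ (subst T (covered-pick p picked) c)
    ... | inj₁ c′ = ⊥-elim (u c′)
    ... | inj₂ pg = inᵇ⇒∈ᵢ pg

    uncovered-outside-choice : ∀ {q} → ¬ T (covered (suc i) q) → ¬ q ∈ᵢ g
    uncovered-outside-choice {q} u qg =
      u (subst T (sym (covered-pick q picked)) (from T-∨ (inj₂ (∈ᵢ⇒inᵇ qg))))

    unfinished-escapes : ∀ {J} → uncovered (suc i) [ J ] ≢ 0 → PointLeft J ⊎ PointRight J
    unfinished-escapes {J} unfinished
      with q , q∈ , h ← count-witness P unfinished
      with _ , eq , here refl , u ← counted⇒owned (suc i) [ J ] h
      with ∉ᵢ⇒outside (uncovered-outside-choice u)
    ... | inj₁ q<l = inj₁ (lose q∈ (eq , q<l))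
    ... | inj₂ r<q = inj₂ (lose q∈ (eq , r<q))

    uncovered-untouched : ∀ {Z} W → (∀ {J} → J ∈ Z → uncovered (suc i) [ J ] ≢ 0) →
                          W ⊆ filter (∁? straddles?) Z → uncovered i W ≤ uncovered (suc i) W
    uncovered-untouched {Z} W unfinished W⊆ = count-mono P λ {p} p∈ h →
      let J , e , J∈W , u = counted⇒owned i W h
          J∈Z , ¬straddles = ∈-filter⁻ (∁? straddles?) (W⊆ J∈W)
          touched c = ¬straddles (lose p∈ (e , newly-covered-in-choice c u) ,
                                  unfinished-escapes (unfinished J∈Z))
      in owned⇒counted (suc i) W e J∈W touched

    retire-straddling : ∀ Z → (∀ {J} → J ∈ Z → uncovered (suc i) [ J ] ≢ 0) → Retirement i Z
    retire-straddling Z unfinished = retirement (drop d Zn) fewer (begin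
      uncovered i Z
        ≤⟨ uncovered-⊆-++ i Zs Zn (filter-++-∁-⊇ straddles? Z) ⟩
      uncovered i Zs + uncovered i Zn
        ≤⟨ +-monoʳ-≤ (uncovered i Zs) (uncovered-drop i (uncovered-singleton i) d Zn) ⟩
      uncovered i Zs + (d * increment i + uncovered i (drop d Zn))
        ≡⟨ +-assoc (uncovered i Zs) _ _ ⟨
      (uncovered i Zs + d * increment i) + uncovered i (drop d Zn)
        ≤⟨ +-mono-≤ (pad-to-two (length Zs) (uncovered-length i Zs) (uncovered-straddling Zs straddling))
                    (uncovered-untouched (drop d Zn) unfinished (drop-⊆ d Zn)) ⟩
      2 * increment i + uncovered (suc i) (drop d Zn) ∎)
      where
      open ≤-Reasoning
      Zs = filter straddles? Z
      Zn = filter (∁? straddles?) Z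
      d = 2 ∸ length Zs
      straddling : ∀ {J} → J ∈ Zs → Straddles J
      straddling = proj₂ ∘ ∈-filter⁻ straddles? {xs = Z}
      fewer : length (drop d Zn) ≤ length Z ∸ 2
      fewer = begin
        length (drop d Zn)             ≡⟨ length-drop d Zn ⟩
        length Zn ∸ d                  ≤⟨ ∸-∸-≤ (length Zs) (length Zn) ⟩
        (length Zs + length Zn) ∸ 2    ≡⟨ cong (_∸ 2) (length-filter-+-∁ straddles? Z) ⟩
        length Z ∸ 2                   ∎

  retire : ∀ i Z → Retirement i Z
  retire i Z with step i
  ... | halt halted _ = retire-halt Z halted
  ... | pick g picked _ with any? (λ J → uncovered (suc i) [ J ] Data.Nat.≟ 0) Z
  ...   | yes finished = let _ , x∈ , done = find finished in retire-finished x∈ done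
  ...   | no unfinished =
    Straddling.retire-straddling i g picked Z (λ J∈ done → unfinished (lose J∈ done))

  greedy-gains-half : ∀ t i Z → length Z ≤ 2 * t →
                      uncovered i Z + 2 * greedyMeasure i ≤ 2 * greedyMeasure (t + i)
  greedy-gains-half zero    i []      _   = ≤-reflexive (cong (_+ 2 * greedyMeasure i) (uncovered-[] i))
  greedy-gains-half (suc t) i Z       len = begin
    uncovered i Z + 2 * greedyMeasure i
      ≤⟨ +-monoˡ-≤ (2 * greedyMeasure i) uncovered-bound ⟩
    (2 * increment i + uncovered (suc i) survivors) + 2 * greedyMeasure i
      ≡⟨ rearrange (increment i) (uncovered (suc i) survivors) (greedyMeasure i) ⟩
    uncovered (suc i) survivors + 2 * (greedyMeasure i + increment i)
      ≤⟨ +-monoʳ-≤ (uncovered (suc i) survivors) (*-monoʳ-≤ 2 (greedyMeasure-suc i)) ⟩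
    uncovered (suc i) survivors + 2 * greedyMeasure (suc i)
      ≤⟨ greedy-gains-half t (suc i) survivors fewer ⟩
    2 * greedyMeasure (t + suc i)
      ≡⟨ cong (λ n → 2 * greedyMeasure n) (+-suc t i) ⟩
    2 * greedyMeasure (suc t + i) ∎
    where
    open ≤-Reasoning
    open Retirement (retire i Z)
    rearrange : ∀ a u m → (2 * a + u) + 2 * m ≡ u + 2 * (m + a)
    rearrange = solve-∀
    fewer : length survivors ≤ 2 * t
    fewer = ≤-trans survivors-fewer (≤-trans (∸-monoˡ-≤ 2 len) (≤-reflexive (cong (_∸ 2) (*-suc 2 t))))

  three-quarters : ∀ h → length Y ≤ 2 * h → 3 * measure P Y ≤ 4 * greedyMeasure (h + h)
  three-quarters h len = begin
    3 * measure P Y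
      ≤⟨ +-mono-≤ ‖Y‖≤2g (*-monoʳ-≤ 2 (measure-≤-uncovered h)) ⟩
    2 * greedyMeasure h + 2 * (greedyMeasure h + uncovered h Y)
      ≡⟨ regroup (greedyMeasure h) (uncovered h Y) ⟩
    2 * (uncovered h Y + 2 * greedyMeasure h)
      ≤⟨ *-monoʳ-≤ 2 (greedy-gains-half h h Y len) ⟩
    2 * (2 * greedyMeasure (h + h))
      ≡⟨ *-assoc 2 2 (greedyMeasure (h + h)) ⟨
    4 * greedyMeasure (h + h) ∎
    where
    open ≤-Reasoning
    regroup : ∀ g u → 2 * g + 2 * (g + u) ≡ 2 * (u + 2 * g)
    regroup = solve-∀
    ‖Y‖≤2g : measure P Y ≤ 2 * greedyMeasure h
    ‖Y‖≤2g = begin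
      measure P Y                                   ≤⟨ measure-≤-uncovered 0 ⟩
      greedyMeasure 0 + uncovered 0 Y               ≡⟨ cong (_+ uncovered 0 Y) greedyMeasure-zero ⟩
      uncovered 0 Y                                 ≤⟨ m≤m+n (uncovered 0 Y) _ ⟩
      uncovered 0 Y + 2 * greedyMeasure 0           ≤⟨ greedy-gains-half h 0 Y len ⟩
      2 * greedyMeasure (h + 0)                     ≡⟨ cong (λ n → 2 * greedyMeasure n) (+-identityʳ h) ⟩
      2 * greedyMeasure h                           ∎

choose-sound : ∀ {A : Set} t (xs : List A) {Y} → Y ∈ choose t xs → length Y ≡ t × Y ⊆ xs
choose-sound zero    xs       (here refl) = refl , λ ()
choose-sound (suc t) (x ∷ xs) Y∈ with ∈-++⁻ (map (x ∷_) (choose t xs)) Y∈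
... | inj₂ Y∈′ = let len , Y⊆ = choose-sound (suc t) xs Y∈′ in len , xs⊆x∷xs xs x ∘ Y⊆
... | inj₁ Y∈′ with _ , Y′∈ , refl ← ∈-map⁻ (x ∷_) Y∈′ =
  let len , Y⊆ = choose-sound t xs Y′∈ in cong suc len , ∷⁺ʳ x Y⊆

*-maximum-≤ : ∀ c {b} ns → (∀ {n} → n ∈ ns → c * n ≤ b) → c * maximum ns ≤ b
*-maximum-≤ c []       _     = ≤-trans (≤-reflexive (*-zeroʳ c)) z≤n
*-maximum-≤ c {b} (n ∷ ns) bound = begin
  c * (n ⊔ maximum ns)      ≡⟨ *-distribˡ-⊔ c n (maximum ns) ⟩
  c * n ⊔ c * maximum ns    ≤⟨ ⊔-lub (bound (here refl)) (*-maximum-≤ c ns (bound ∘ there)) ⟩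
  b                         ∎
  where open ≤-Reasoning

mainTheorem8 : (P : List ℚ) (I : List Interval) → ValidInstance P I →
    (k : ℕ) → 2 ∣ k → 0 < k → k ≤ length I →
    3 * opt P I k ≤ 4 * measure P (greedy P I k)
mainTheorem8 P I _ _ (divides h refl) _ _ = *-maximum-≤ 3 (map (measure P) (choose (h * 2) I)) bound
  where
  bound : ∀ {n} → n ∈ map (measure P) (choose (h * 2) I) → 3 * n ≤ 4 * measure P (greedy P I (h * 2))
  bound n∈ with Y , Y∈ , refl ← ∈-map⁻ (measure P) n∈ =
    let len , Y⊆I = choose-sound (h * 2) I Y∈ in
    subst (λ k → 3 * measure P Y ≤ 4 * measure P (greedy P I k))
          (sym (trans (*-comm h 2) (cong (h +_) (+-identityʳ h))))
      (Uncovered.three-quarters P I Y Y⊆I h (≤-reflexive (trans len (*-comm h 2))))
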